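{- For every integer $d>0$, $f^*(2,d)=1+\frac{1}{d}$.
   Context: For integers $n\geq 1$, $d\geq 1$, the triangular grid is $T_d(n):=\{(x_1,\dots,x_d)\in\mathbb{Z}_{\geq 0}^d : x_1+\dots+x_d\leq n-1\}$. A fractional cover of $T_d(n)$ is an assignment of nonnegative weights $w(H)$ to the affine hyperplanes $H$ of $\mathbb{R}^d$ (finitely many nonzero) such that $\sum_{H\ni p}w(H)\geq 1$ for every $p\in T_d(n)$; $f^*(n,d)$ is the minimum of $\sum_H w(H)$ over all fractional covers of $T_d(n)$.
   Formalization: The weights $w(H)$ take values in the rationals, and the hyperplanes $H$ are affine hyperplanes of ℚ^d rather than of ℝ^d. -}

module Defs where

open import Data.Nat as ℕ using (ℕ; zero; suc; _<_)
open import Data.Fin using (Fin; zero; suc)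
open import Data.Integer using (+_)
open import Data.Rational using (ℚ; 0ℚ; 1ℚ; _+_; _*_; _/_; _≤_)
open import Data.Rational.Properties using (_≟_)
open import Data.List using (List; []; _∷_)
open import Data.Product using (Σ; _×_; _,_; ∃)
open import Relation.Binary.PropositionalEquality using (_≡_; _≢_)
open import Relation.Nullary using (yes; no)

sumℕ : (d : ℕ) → (Fin d → ℕ) → ℕ
sumℕ zero    f = 0
sumℕ (suc d) f = f zero ℕ.+ sumℕ d (λ i → f (suc i))

sumℚ : (d : ℕ) → (Fin d → ℚ) → ℚ
sumℚ zero    f = 0ℚ
sumℚ (suc d) f = f zero + sumℚ d (λ i → f (suc i))

Point : ℕ → Set
Point d = Fin d → ℕ

-- The triangular grid T_d(n): x₁+…+x_d ≤ n-1, i.e. x₁+…+x_d < n.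
InT : (n d : ℕ) → Point d → Set
InT n d p = sumℕ d p < n

record Hyperplane (d : ℕ) : Set where
  constructor hyperplane
  field
    normal    : Fin d → ℚ
    offset    : ℚ
    nonzeroNormal : ∃ λ i → normal i ≢ 0ℚ

toℚ : ℕ → ℚ
toℚ x = + x / 1

_∈H_ : {d : ℕ} → Point d → Hyperplane d → Set
_∈H_ {d} p H = sumℚ d (λ i → Hyperplane.normal H i * toℚ (p i)) ≡ Hyperplane.offset H

WeightedFamily : ℕ → Set
WeightedFamily d = List (Hyperplane d × ℚ)

totalWeight : {d : ℕ} → WeightedFamily d → ℚ
totalWeight []            = 0ℚ
totalWeight ((_ , w) ∷ F) = w + totalWeight F

weightAt : {d : ℕ} → WeightedFamily d → Point d → ℚ
weightAt []            p = 0ℚ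
weightAt {d} ((H , w) ∷ F) p with sumℚ d (λ i → Hyperplane.normal H i * toℚ (p i)) ≟ Hyperplane.offset H
... | yes _ = w + weightAt F p
... | no  _ = weightAt F p

data AllNonneg {d : ℕ} : WeightedFamily d → Set where
  []  : AllNonneg []
  _∷_ : ∀ {H w F} → 0ℚ ≤ w → AllNonneg F → AllNonneg ((H , w) ∷ F)

IsFractionalCover : (n d : ℕ) → WeightedFamily d → Set
IsFractionalCover n d F =
  AllNonneg F × ((p : Point d) → InT n d p → 1ℚ ≤ weightAt F p)

FStarEq : (n d : ℕ) → ℚ → Set
FStarEq n d v =
  (Σ (WeightedFamily d) λ F → IsFractionalCover n d F × totalWeight F ≡ v)
  × ((F : WeightedFamily d) → IsFractionalCover n d F → v ≤ totalWeight F)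

{-# OPTIONS --safe #-}
-- Upper bound: give weight 1/d to each of the d + 1 facet hyperplanes of the standard
-- simplex, x_j = 0 and x₁ + … + x_d = 1.  The points of T_d(2) are the vertices
-- 0, e₁, …, e_d; the origin lies on the d coordinate facets and e_j on the other d − 1
-- coordinate facets and on the far one, so every point receives weight d · (1/d) = 1.
-- Lower bound: each of the d + 1 vertices needs weight at least 1, so the total coverage
-- of the vertices is at least d + 1.  As the vertices are affinely independent, a
-- hyperplane H contains at most d of them and contributes at most d · w(H); hence
-- d · Σ w(H) ≥ d + 1.
module Submission where

open import Defs
open import Data.Nat using (ℕ; NonZero)
open import Data.Integer using (+_)
open import Data.Rational using (1ℚ; _+_; _/_)

open import Algebra.Bundles using (Ring)
open import Data.Nat as ℕ using (zero; suc; z≤n; s≤s)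
import Data.Integer as ℤ
import Data.Integer.Properties as ℤ
open import Data.Rational using (ℚ; 0ℚ; _*_; _≤_; fromℚᵘ; toℚᵘ)
import Data.Rational.Properties as ℚ
open import Data.Rational.Unnormalised as ℚᵘ using (mkℚᵘ; *≡*)
import Data.Rational.Unnormalised.Properties as ℚᵘ
open import Algebra.Properties.Semiring.Sum (Ring.semiring ℚ.+-*-ring)
  using (sum; sum-remove; ∑-distrib-+)
open import Algebra.Properties.Semiring.Mult (Ring.semiring ℚ.+-*-ring)
  using (_×_; ×-homo-+; ×-comm-*; ×-assoc-*)
open import Algebra.Properties.CommutativeMonoid.Mult ℚ.+-0-commutativeMonoid
  using (×-distrib-+)
open import Data.Fin using (Fin; zero; suc)
open import Data.Vec.Functional using (removeAt)
open import Data.List using ([]; _∷_)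
open import Data.Product using (∃; _,_; proj₁; proj₂)
open import Relation.Nullary using (¬_; Dec; yes; no; contradiction)
open import Relation.Binary.PropositionalEquality

fromℚᵘ-homo-+ : ∀ p q → fromℚᵘ (p ℚᵘ.+ q) ≡ fromℚᵘ p + fromℚᵘ q
fromℚᵘ-homo-+ p q = ℚ.toℚᵘ-injective (begin-equality
  toℚᵘ (fromℚᵘ (p ℚᵘ.+ q))              ≃⟨ ℚ.toℚᵘ-fromℚᵘ (p ℚᵘ.+ q) ⟩
  p ℚᵘ.+ q                              ≃⟨ ℚᵘ.+-cong (ℚᵘ.≃-sym (ℚ.toℚᵘ-fromℚᵘ p))
                                                     (ℚᵘ.≃-sym (ℚ.toℚᵘ-fromℚᵘ q)) ⟩
  toℚᵘ (fromℚᵘ p) ℚᵘ.+ toℚᵘ (fromℚᵘ q)  ≃⟨ ℚ.toℚᵘ-homo-+ (fromℚᵘ p) (fromℚᵘ q) ⟨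
  toℚᵘ (fromℚᵘ p + fromℚᵘ q)            ∎)
  where open ℚᵘ.≤-Reasoning

fromℚᵘ-homo-* : ∀ p q → fromℚᵘ (p ℚᵘ.* q) ≡ fromℚᵘ p * fromℚᵘ q
fromℚᵘ-homo-* p q = ℚ.toℚᵘ-injective (begin-equality
  toℚᵘ (fromℚᵘ (p ℚᵘ.* q))              ≃⟨ ℚ.toℚᵘ-fromℚᵘ (p ℚᵘ.* q) ⟩
  p ℚᵘ.* q                              ≃⟨ ℚᵘ.*-cong (ℚᵘ.≃-sym (ℚ.toℚᵘ-fromℚᵘ p))
                                                     (ℚᵘ.≃-sym (ℚ.toℚᵘ-fromℚᵘ q)) ⟩
  toℚᵘ (fromℚᵘ p) ℚᵘ.* toℚᵘ (fromℚᵘ q)  ≃⟨ ℚ.toℚᵘ-homo-* (fromℚᵘ p) (fromℚᵘ q) ⟨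
  toℚᵘ (fromℚᵘ p * fromℚᵘ q)            ∎)
  where open ℚᵘ.≤-Reasoning

-- toℚ n and + 1 / suc k are, by definition, fromℚᵘ (mkℚᵘ (+ n) 0) and fromℚᵘ (mkℚᵘ (+ 1) k),
-- so identities between them can be checked on unnormalised fractions.
toℚ-+ : ∀ m n → toℚ (m ℕ.+ n) ≡ toℚ m + toℚ n
toℚ-+ m n = trans (ℚ.fromℚᵘ-cong {mkℚᵘ (+ (m ℕ.+ n)) 0} {mkℚᵘ (+ m) 0 ℚᵘ.+ mkℚᵘ (+ n) 0}
                                  (*≡* cross))
                  (fromℚᵘ-homo-+ (mkℚᵘ (+ m) 0) (mkℚᵘ (+ n) 0))
  where
  cross : + (m ℕ.+ n) ℤ.* + 1 ≡ (+ m ℤ.* + 1 ℤ.+ + n ℤ.* + 1) ℤ.* + 1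
  cross = begin
    + (m ℕ.+ n) ℤ.* + 1                    ≡⟨ ℤ.*-identityʳ _ ⟩
    + (m ℕ.+ n)                            ≡⟨ ℤ.pos-+ m n ⟩
    + m ℤ.+ + n                            ≡⟨ cong₂ ℤ._+_ (ℤ.*-identityʳ (+ m)) (ℤ.*-identityʳ (+ n)) ⟨
    + m ℤ.* + 1 ℤ.+ + n ℤ.* + 1            ≡⟨ ℤ.*-identityʳ _ ⟨
    (+ m ℤ.* + 1 ℤ.+ + n ℤ.* + 1) ℤ.* + 1  ∎
    where open ≡-Reasoning

×≡toℚ* : ∀ n x → n × x ≡ toℚ n * x
×≡toℚ* zero    x = sym (ℚ.*-zeroˡ x)
×≡toℚ* (suc n) x = begin
  x + n × x           ≡⟨ cong₂ _+_ (sym (ℚ.*-identityˡ x)) (×≡toℚ* n x) ⟩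
  1ℚ * x + toℚ n * x  ≡⟨ ℚ.*-distribʳ-+ x 1ℚ (toℚ n) ⟨
  (1ℚ + toℚ n) * x    ≡⟨ cong (_* x) (toℚ-+ 1 n) ⟨
  toℚ (suc n) * x     ∎
  where open ≡-Reasoning

-- ℚᵘ.1/ (mkℚᵘ (+ suc k) 0) computes to mkℚᵘ (+ 1) k.
n×[1/n]≡1 : ∀ n .{{_ : NonZero n}} → n × (+ 1 / n) ≡ 1ℚ
n×[1/n]≡1 (suc k) = begin
  suc k × (+ 1 / suc k)
    ≡⟨ ×≡toℚ* (suc k) _ ⟩
  toℚ (suc k) * (+ 1 / suc k)
    ≡⟨ fromℚᵘ-homo-* (mkℚᵘ (+ suc k) 0) (mkℚᵘ (+ 1) k) ⟨
  fromℚᵘ (mkℚᵘ (+ suc k) 0 ℚᵘ.* mkℚᵘ (+ 1) k)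
    ≡⟨ ℚ.fromℚᵘ-cong (ℚᵘ.*-inverseʳ (mkℚᵘ (+ suc k) 0)) ⟩
  1ℚ
    ∎
  where open ≡-Reasoning

[1/n]*[n×x]≡x : ∀ n .{{_ : NonZero n}} x → (+ 1 / n) * (n × x) ≡ x
[1/n]*[n×x]≡x n x = begin
  (+ 1 / n) * (n × x)  ≡⟨ ×-comm-* n (+ 1 / n) x ⟩
  n × ((+ 1 / n) * x)  ≡⟨ ×-assoc-* n (+ 1 / n) x ⟨
  (n × (+ 1 / n)) * x  ≡⟨ cong (_* x) (n×[1/n]≡1 n) ⟩
  1ℚ * x               ≡⟨ ℚ.*-identityˡ x ⟩
  x                    ∎
  where open ≡-Reasoning

[1/n]≥0 : ∀ n .{{_ : NonZero n}} → 0ℚ ≤ + 1 / n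
[1/n]≥0 n = ℚ.nonNegative⁻¹ (+ 1 / n) {{ℚ.normalize-nonNeg 1 n}}

×-nonNeg : ∀ n {x} → 0ℚ ≤ x → 0ℚ ≤ n × x
×-nonNeg zero    x≥0 = ℚ.≤-refl
×-nonNeg (suc n) x≥0 = ℚ.+-mono-≤ x≥0 (×-nonNeg n x≥0)

p≤p+q : ∀ p {q} → 0ℚ ≤ q → p ≤ p + q
p≤p+q p q≥0 = ℚ.≤-trans (ℚ.≤-reflexive (sym (ℚ.+-identityʳ p))) (ℚ.+-monoʳ-≤ p q≥0)

sumℚ≡sum : ∀ n (f : Fin n → ℚ) → sumℚ n f ≡ sum f
sumℚ≡sum zero    f = refl
sumℚ≡sum (suc n) f = cong (λ s → f zero + s) (sumℚ≡sum n (λ i → f (suc i)))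

sumℚ-cong : ∀ n {f g : Fin n → ℚ} → (∀ i → f i ≡ g i) → sumℚ n f ≡ sumℚ n g
sumℚ-cong zero    f≗g = refl
sumℚ-cong (suc n) f≗g = cong₂ _+_ (f≗g zero) (sumℚ-cong n (λ i → f≗g (suc i)))

sumℚ-distrib-+ : ∀ n (f g : Fin n → ℚ) → sumℚ n (λ i → f i + g i) ≡ sumℚ n f + sumℚ n g
sumℚ-distrib-+ n f g = begin
  sumℚ n (λ i → f i + g i)  ≡⟨ sumℚ≡sum n _ ⟩
  sum (λ i → f i + g i)     ≡⟨ ∑-distrib-+ f g ⟩
  sum f + sum g             ≡⟨ cong₂ _+_ (sumℚ≡sum n f) (sumℚ≡sum n g) ⟨
  sumℚ n f + sumℚ n g       ∎
  where open ≡-Reasoning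

sumℚ-zero : ∀ n → sumℚ n (λ _ → 0ℚ) ≡ 0ℚ
sumℚ-zero zero    = refl
sumℚ-zero (suc n) = trans (ℚ.+-identityˡ _) (sumℚ-zero n)

sumℚ-≤-× : ∀ n {f : Fin n → ℚ} {w} → (∀ i → f i ≤ w) → sumℚ n f ≤ n × w
sumℚ-≤-× zero    f≤w = ℚ.≤-refl
sumℚ-≤-× (suc n) f≤w = ℚ.+-mono-≤ (f≤w zero) (sumℚ-≤-× n (λ i → f≤w (suc i)))

×-≤-sumℚ : ∀ n {f : Fin n → ℚ} {w} → (∀ i → w ≤ f i) → n × w ≤ sumℚ n f
×-≤-sumℚ zero    w≤f = ℚ.≤-refl
×-≤-sumℚ (suc n) w≤f = ℚ.+-mono-≤ (w≤f zero) (×-≤-sumℚ n (λ i → w≤f (suc i)))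

sumℚ-vanishing-≤-× : ∀ n {f : Fin (suc n) → ℚ} {w} i → f i ≡ 0ℚ → (∀ j → f j ≤ w) →
                     sumℚ (suc n) f ≤ n × w
sumℚ-vanishing-≤-× n {f} {w} i fᵢ≡0 f≤w = begin
  sumℚ (suc n) f               ≡⟨ sumℚ≡sum (suc n) f ⟩
  sum f                        ≡⟨ sum-remove {i = i} f ⟩
  f i + sum (removeAt f i)     ≡⟨ cong (λ s → f i + s) (sumℚ≡sum n (removeAt f i)) ⟨
  f i + sumℚ n (removeAt f i)  ≡⟨ cong (_+ sumℚ n (removeAt f i)) fᵢ≡0 ⟩
  0ℚ + sumℚ n (removeAt f i)   ≡⟨ ℚ.+-identityˡ _ ⟩
  sumℚ n (removeAt f i)        ≤⟨ sumℚ-≤-× n (λ j → f≤w _) ⟩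
  n × w                        ∎
  where open ℚ.≤-Reasoning

sumℚ-× : ∀ n (p : Fin n → ℕ) x → sumℚ n (λ i → p i × x) ≡ sumℕ n p × x
sumℚ-× zero    p x = refl
sumℚ-× (suc n) p x = begin
  p zero × x + sumℚ n (λ i → p (suc i) × x)
    ≡⟨ cong (λ s → p zero × x + s) (sumℚ-× n (λ i → p (suc i)) x) ⟩
  p zero × x + sumℕ n (λ i → p (suc i)) × x
    ≡⟨ ×-homo-+ x (p zero) _ ⟨
  sumℕ (suc n) p × x
    ∎
  where open ≡-Reasoning

toℚ-sumℕ : ∀ n (p : Fin n → ℕ) → toℚ (sumℕ n p) ≡ sumℚ n (λ i → toℚ (p i))
toℚ-sumℕ zero    p = refl
toℚ-sumℕ (suc n) p = trans (toℚ-+ (p zero) _)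
                           (cong (λ s → toℚ (p zero) + s) (toℚ-sumℕ n (λ i → p (suc i))))

_∈H?_ : ∀ {d} (p : Point d) (H : Hyperplane d) → Dec (p ∈H H)
_∈H?_ {d} p H = sumℚ d (λ i → Hyperplane.normal H i * toℚ (p i)) ℚ.≟ Hyperplane.offset H

weightAt₁ : ∀ {d} → Hyperplane d → ℚ → Point d → ℚ
weightAt₁ H w p with p ∈H? H
... | yes _ = w
... | no  _ = 0ℚ

weightAt-∷ : ∀ {d} (H : Hyperplane d) w F p → weightAt ((H , w) ∷ F) p ≡ weightAt₁ H w p + weightAt F p
weightAt-∷ H w F p with p ∈H? H
... | yes _ = refl
... | no  _ = sym (ℚ.+-identityˡ _)

weightAt₁-∈ : ∀ {d} (H : Hyperplane d) {w} p → p ∈H H → weightAt₁ H w p ≡ w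
weightAt₁-∈ H p p∈H with p ∈H? H
... | yes _   = refl
... | no  p∉H = contradiction p∈H p∉H

weightAt₁-∉ : ∀ {d} (H : Hyperplane d) {w} p → ¬ p ∈H H → weightAt₁ H w p ≡ 0ℚ
weightAt₁-∉ H p p∉H with p ∈H? H
... | yes p∈H = contradiction p∈H p∉H
... | no  _   = refl

weightAt₁-nonNeg : ∀ {d} (H : Hyperplane d) {w} p → 0ℚ ≤ w → 0ℚ ≤ weightAt₁ H w p
weightAt₁-nonNeg H p w≥0 with p ∈H? H
... | yes _ = w≥0
... | no  _ = ℚ.≤-refl

weightAt₁-≤ : ∀ {d} (H : Hyperplane d) {w} p → 0ℚ ≤ w → weightAt₁ H w p ≤ w
weightAt₁-≤ H p w≥0 with p ∈H? H
... | yes _ = ℚ.≤-refl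
... | no  _ = w≥0

origin : ∀ {d} → Point d
origin _ = 0

unit : ∀ {d} → Fin d → Point d
unit zero    zero    = 1
unit zero    (suc i) = 0
unit (suc j) zero    = 0
unit (suc j) (suc i) = unit j i

unit-diag : ∀ {d} (j : Fin d) → unit j j ≡ 1
unit-diag zero    = refl
unit-diag (suc j) = unit-diag j

sumℕ-origin : ∀ d → sumℕ d origin ≡ 0
sumℕ-origin zero    = refl
sumℕ-origin (suc d) = sumℕ-origin d

sumℕ-unit : ∀ d (j : Fin d) → sumℕ d (unit j) ≡ 1
sumℕ-unit (suc d) zero    = cong suc (sumℕ-origin d)
sumℕ-unit (suc d) (suc j) = sumℕ-unit d j

sumℚ-*-origin : ∀ d (a : Fin d → ℚ) → sumℚ d (λ i → a i * toℚ (origin i)) ≡ 0ℚ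
sumℚ-*-origin d a = trans (sumℚ-cong d (λ i → ℚ.*-zeroʳ (a i))) (sumℚ-zero d)

sumℚ-*-unit : ∀ d (a : Fin d → ℚ) j → sumℚ d (λ i → a i * toℚ (unit j i)) ≡ a j
sumℚ-*-unit (suc d) a zero    = begin
  a zero * 1ℚ + sumℚ d (λ i → a (suc i) * 0ℚ)
    ≡⟨ cong₂ _+_ (ℚ.*-identityʳ (a zero)) (sumℚ-*-origin d (λ i → a (suc i))) ⟩
  a zero + 0ℚ
    ≡⟨ ℚ.+-identityʳ (a zero) ⟩
  a zero
    ∎
  where open ≡-Reasoning
sumℚ-*-unit (suc d) a (suc j) = begin
  a zero * 0ℚ + sumℚ d (λ i → a (suc i) * toℚ (unit j i))
    ≡⟨ cong₂ _+_ (ℚ.*-zeroʳ (a zero)) (sumℚ-*-unit d (λ i → a (suc i)) j) ⟩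
  0ℚ + a (suc j)
    ≡⟨ ℚ.+-identityˡ (a (suc j)) ⟩
  a (suc j)
    ∎
  where open ≡-Reasoning

vertex : ∀ {d} → Fin (suc d) → Point d
vertex zero    = origin
vertex (suc j) = unit j

vertex-∈T : ∀ d i → InT 2 d (vertex i)
vertex-∈T d zero    rewrite sumℕ-origin d  = s≤s z≤n
vertex-∈T d (suc j) rewrite sumℕ-unit d j = s≤s (s≤s z≤n)

vertices-not-coplanar : ∀ {d} (H : Hyperplane d) → ∃ λ i → ¬ vertex i ∈H H
vertices-not-coplanar {d} H with origin ∈H? H
... | no  0∉H = zero , 0∉H
... | yes 0∈H = suc j , eⱼ∉H
  where
  open Hyperplane H
  j : Fin d
  j = proj₁ nonzeroNormal
  offset≡0 : offset ≡ 0ℚ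
  offset≡0 = trans (sym 0∈H) (sumℚ-*-origin d normal)
  eⱼ∉H : ¬ unit j ∈H H
  eⱼ∉H eⱼ∈H = proj₂ nonzeroNormal (trans (sym (sumℚ-*-unit d normal j)) (trans eⱼ∈H offset≡0))

sumℚ-weightAt-≤ : ∀ {d} k (q : Fin (suc k) → Point d) → (∀ H → ∃ λ i → ¬ q i ∈H H) →
                  ∀ F → AllNonneg F → sumℚ (suc k) (λ i → weightAt F (q i)) ≤ k × totalWeight F
sumℚ-weightAt-≤ k q missed []            []          =
  sumℚ-vanishing-≤-× k zero refl (λ _ → ℚ.≤-refl)
sumℚ-weightAt-≤ k q missed ((H , w) ∷ F) (w≥0 ∷ F≥0) = begin
  sumℚ (suc k) (λ i → weightAt ((H , w) ∷ F) (q i))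
    ≡⟨ sumℚ-cong (suc k) (λ i → weightAt-∷ H w F (q i)) ⟩
  sumℚ (suc k) (λ i → weightAt₁ H w (q i) + weightAt F (q i))
    ≡⟨ sumℚ-distrib-+ (suc k) (λ i → weightAt₁ H w (q i)) (λ i → weightAt F (q i)) ⟩
  sumℚ (suc k) (λ i → weightAt₁ H w (q i)) + sumℚ (suc k) (λ i → weightAt F (q i))
    ≤⟨ ℚ.+-mono-≤ onH (sumℚ-weightAt-≤ k q missed F F≥0) ⟩
  k × w + k × totalWeight F
    ≡⟨ ×-distrib-+ w (totalWeight F) k ⟨
  k × (w + totalWeight F)
    ∎
  where
  open ℚ.≤-Reasoning
  onH : sumℚ (suc k) (λ i → weightAt₁ H w (q i)) ≤ k × w
  onH = sumℚ-vanishing-≤-× k (proj₁ (missed H)) (weightAt₁-∉ H (q _) (proj₂ (missed H)))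
                           (λ i → weightAt₁-≤ H (q i) w≥0)

fractionalCover-≥ : ∀ d .{{_ : NonZero d}} F → IsFractionalCover 2 d F → 1ℚ + + 1 / d ≤ totalWeight F
fractionalCover-≥ d F (F≥0 , covers) = begin
  1ℚ + u                   ≡⟨ ℚ.+-comm 1ℚ u ⟩
  u + 1ℚ                   ≡⟨ cong₂ _+_ (ℚ.*-identityʳ u) ([1/n]*[n×x]≡x d 1ℚ) ⟨
  u * 1ℚ + u * (d × 1ℚ)    ≡⟨ ℚ.*-distribˡ-+ u 1ℚ (d × 1ℚ) ⟨
  u * (suc d × 1ℚ)         ≤⟨ ℚ.*-monoˡ-≤-nonNeg u {{ℚ.normalize-nonNeg 1 d}} onVertices ⟩
  u * (d × totalWeight F)  ≡⟨ [1/n]*[n×x]≡x d (totalWeight F) ⟩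
  totalWeight F            ∎
  where
  open ℚ.≤-Reasoning
  u : ℚ
  u = + 1 / d
  onVertices : suc d × 1ℚ ≤ d × totalWeight F
  onVertices = ℚ.≤-trans (×-≤-sumℚ (suc d) (λ i → covers (vertex i) (vertex-∈T d i)))
                         (sumℚ-weightAt-≤ d vertex vertices-not-coplanar F F≥0)

uniformFamily : ∀ {d} k → (Fin k → Hyperplane d) → ℚ → WeightedFamily d
uniformFamily zero    H w = []
uniformFamily (suc k) H w = (H zero , w) ∷ uniformFamily k (λ j → H (suc j)) w

totalWeight-uniformFamily : ∀ {d} k (H : Fin k → Hyperplane d) w →
                            totalWeight (uniformFamily k H w) ≡ k × w
totalWeight-uniformFamily zero    H w = refl
totalWeight-uniformFamily (suc k) H w =
  cong (λ s → w + s) (totalWeight-uniformFamily k (λ j → H (suc j)) w)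

weightAt-uniformFamily : ∀ {d} k (H : Fin k → Hyperplane d) w p →
                         weightAt (uniformFamily k H w) p ≡ sumℚ k (λ j → weightAt₁ (H j) w p)
weightAt-uniformFamily zero    H w p = refl
weightAt-uniformFamily (suc k) H w p =
  trans (weightAt-∷ (H zero) w _ p)
        (cong (λ s → weightAt₁ (H zero) w p + s) (weightAt-uniformFamily k (λ j → H (suc j)) w p))

uniformFamily-nonNeg : ∀ {d} k (H : Fin k → Hyperplane d) {w} → 0ℚ ≤ w →
                       AllNonneg (uniformFamily k H w)
uniformFamily-nonNeg zero    H w≥0 = []
uniformFamily-nonNeg (suc k) H w≥0 = w≥0 ∷ uniformFamily-nonNeg k (λ j → H (suc j)) w≥0

coordinateHyperplane : ∀ {d} → Fin d → Hyperplane d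
coordinateHyperplane j = hyperplane (λ i → toℚ (unit j i)) 0ℚ (j , normalⱼ≢0)
  where
  normalⱼ≢0 : toℚ (unit j j) ≢ 0ℚ
  normalⱼ≢0 rewrite unit-diag j = ℚ.1≢0

sumOneHyperplane : ∀ k → Hyperplane (suc k)
sumOneHyperplane k = hyperplane (λ _ → 1ℚ) 1ℚ (zero , ℚ.1≢0)

∈-coordinateHyperplane : ∀ {d} (p : Point d) j → p j ≡ 0 → p ∈H coordinateHyperplane j
∈-coordinateHyperplane {d} p j pⱼ≡0 = begin
  sumℚ d (λ i → toℚ (unit j i) * toℚ (p i))  ≡⟨ sumℚ-cong d (λ i → ℚ.*-comm _ (toℚ (p i))) ⟩
  sumℚ d (λ i → toℚ (p i) * toℚ (unit j i))  ≡⟨ sumℚ-*-unit d (λ i → toℚ (p i)) j ⟩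
  toℚ (p j)                                  ≡⟨ cong toℚ pⱼ≡0 ⟩
  0ℚ                                         ∎
  where open ≡-Reasoning

∈-sumOneHyperplane : ∀ k (p : Point (suc k)) → sumℕ (suc k) p ≡ 1 → p ∈H sumOneHyperplane k
∈-sumOneHyperplane k p ∣p∣≡1 = begin
  sumℚ (suc k) (λ i → 1ℚ * toℚ (p i))  ≡⟨ sumℚ-cong (suc k) (λ i → ℚ.*-identityˡ (toℚ (p i))) ⟩
  sumℚ (suc k) (λ i → toℚ (p i))       ≡⟨ toℚ-sumℕ (suc k) p ⟨
  toℚ (sumℕ (suc k) p)                 ≡⟨ cong toℚ ∣p∣≡1 ⟩
  1ℚ                                   ∎
  where open ≡-Reasoning

coordinateHyperplane-bound : ∀ {d} (p : Point d) j {w} → 0ℚ ≤ w →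
                             w ≤ p j × w + weightAt₁ (coordinateHyperplane j) w p
coordinateHyperplane-bound p j w≥0 with p j in pⱼ≡
... | zero  = ℚ.≤-reflexive (sym (trans (ℚ.+-identityˡ _)
                (weightAt₁-∈ (coordinateHyperplane j) p (∈-coordinateHyperplane p j pⱼ≡))))
... | suc m = ℚ.≤-trans (p≤p+q _ (×-nonNeg m w≥0))
                        (p≤p+q _ (weightAt₁-nonNeg (coordinateHyperplane j) p w≥0))

sumOneHyperplane-bound : ∀ k (p : Point (suc k)) {w} → 0ℚ ≤ w → sumℕ (suc k) p ℕ.< 2 →
                         sumℕ (suc k) p × w ≤ weightAt₁ (sumOneHyperplane k) w p
sumOneHyperplane-bound k p w≥0 ∣p∣<2 with sumℕ (suc k) p in ∣p∣≡
sumOneHyperplane-bound k p w≥0 _              | zero     =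
  weightAt₁-nonNeg (sumOneHyperplane k) p w≥0
sumOneHyperplane-bound k p w≥0 _              | suc zero =
  ℚ.≤-reflexive (trans (ℚ.+-identityʳ _)
                       (sym (weightAt₁-∈ (sumOneHyperplane k) p (∈-sumOneHyperplane k p ∣p∣≡))))
sumOneHyperplane-bound k p w≥0 (s≤s (s≤s ())) | suc (suc _)

facetCover : ∀ k → WeightedFamily (suc k)
facetCover k = (sumOneHyperplane k , u) ∷ uniformFamily (suc k) coordinateHyperplane u
  where
  u : ℚ
  u = + 1 / suc k

facetCover-nonNeg : ∀ k → AllNonneg (facetCover k)
facetCover-nonNeg k = [1/n]≥0 (suc k) ∷ uniformFamily-nonNeg (suc k) coordinateHyperplane ([1/n]≥0 (suc k))

totalWeight-facetCover : ∀ k → totalWeight (facetCover k) ≡ 1ℚ + + 1 / suc k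
totalWeight-facetCover k = begin
  u + totalWeight (uniformFamily (suc k) coordinateHyperplane u)
    ≡⟨ cong (λ s → u + s) (totalWeight-uniformFamily (suc k) coordinateHyperplane u) ⟩
  u + suc k × u
    ≡⟨ cong (λ s → u + s) (n×[1/n]≡1 (suc k)) ⟩
  u + 1ℚ
    ≡⟨ ℚ.+-comm u 1ℚ ⟩
  1ℚ + u
    ∎
  where
  open ≡-Reasoning
  u : ℚ
  u = + 1 / suc k

-- Each coordinate j pays u, either through p j ≥ 1 or through the facet x_j = 0; the part
-- paid through the coordinates, |p| · u with |p| ≤ 1, is covered by the facet Σ x_i = 1.
facetCover-covers : ∀ k p → InT 2 (suc k) p → 1ℚ ≤ weightAt (facetCover k) p
facetCover-covers k p p∈T = begin
  1ℚ
    ≡⟨ n×[1/n]≡1 d ⟨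
  d × u
    ≤⟨ ×-≤-sumℚ d (λ j → coordinateHyperplane-bound p j u≥0) ⟩
  sumℚ d (λ j → p j × u + weightAt₁ (coordinateHyperplane j) u p)
    ≡⟨ sumℚ-distrib-+ d (λ j → p j × u) (λ j → weightAt₁ (coordinateHyperplane j) u p) ⟩
  sumℚ d (λ j → p j × u) + onCoordinates
    ≡⟨ cong (_+ onCoordinates) (sumℚ-× d p u) ⟩
  sumℕ d p × u + onCoordinates
    ≤⟨ ℚ.+-monoˡ-≤ onCoordinates (sumOneHyperplane-bound k p u≥0 p∈T) ⟩
  weightAt₁ (sumOneHyperplane k) u p + onCoordinates
    ≡⟨ cong (λ s → weightAt₁ (sumOneHyperplane k) u p + s)
            (weightAt-uniformFamily d coordinateHyperplane u p) ⟨
  weightAt₁ (sumOneHyperplane k) u p + weightAt (uniformFamily d coordinateHyperplane u) p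
    ≡⟨ weightAt-∷ (sumOneHyperplane k) u _ p ⟨
  weightAt (facetCover k) p
    ∎
  where
  open ℚ.≤-Reasoning
  d : ℕ
  d = suc k
  u : ℚ
  u = + 1 / d
  u≥0 : 0ℚ ≤ u
  u≥0 = [1/n]≥0 d
  onCoordinates : ℚ
  onCoordinates = sumℚ d (λ j → weightAt₁ (coordinateHyperplane j) u p)

proposition3p3 : (d : ℕ) → .{{_ : NonZero d}} → FStarEq 2 d (1ℚ + (+ 1 / d))
proposition3p3 (suc k) =
  (facetCover k , (facetCover-nonNeg k , facetCover-covers k) , totalWeight-facetCover k) ,
  fractionalCover-≥ (suc k)
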